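{- Let $\pi\in S_n$. If $1$ and $n$ occupy consecutive positions in the one-line notation of $\pi$ (in either order), with $\pi(1)\ne n$ and $\pi(n)\ne1$, then $\gamma(G_\pi)=2$ and $\{1,n\}$ is a minimum dominating set of $G_\pi$.
   Context: For a permutation $\pi$ of $[n]=\{1,\dots,n\}$ (one-line notation $[\pi(1),\dots,\pi(n)]$), the permutation graph $G_\pi$ has vertex set $[n]$ and an edge between $i<j$ iff $\pi^{ -1}(i)>\pi^{ -1}(j)$. $\gamma(G)$ is the minimum size of a set $D$ of vertices such that every vertex is in $D$ or adjacent to a vertex of $D$ (a minimum dominating set). -}

module Defs where

open import Data.Nat using (ℕ; suc)
open import Data.Fin using (Fin; _<_)
open import Data.Fin.Permutation using (Permutation′; _⟨$⟩ʳ_; _⟨$⟩ˡ_)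
open import Data.Fin.Subset using (Subset; _∈_)
open import Data.Product using (∃; _×_)
open import Data.Sum using (_⊎_)

-- Vertices / positions / values are Fin n; Fin index k stands for k+1.
-- π ⟨$⟩ʳ p is the value at position p (π(p)); π ⟨$⟩ˡ v is the position of v (π⁻¹(v)).

Inversion : ∀ {n} → Permutation′ n → Fin n → Fin n → Set
Inversion π i j = i < j × (π ⟨$⟩ˡ j) < (π ⟨$⟩ˡ i)

Adj : ∀ {n} → Permutation′ n → Fin n → Fin n → Set
Adj π u v = Inversion π u v ⊎ Inversion π v u

Dominating : ∀ {n} → Permutation′ n → Subset n → Set
Dominating {n} π D = (v : Fin n) → v ∈ D ⊎ ∃ (λ u → u ∈ D × Adj π u v)

module Submission where

-- Everything rests on the neighbourhoods of the two extreme vertices: the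
-- least vertex 1 is adjacent exactly to the vertices placed to its left, and
-- the greatest vertex n exactly to the vertices placed to its right.
--   * Upper bound: if n stands at most one place right of 1, every vertex is
--     left of 1, right of n, or one of them, so {1, n} dominates.
--   * Lower bound: a dominating set with fewer than two elements is a single
--     universal vertex u.  Here u = 1 misses π(n), u = n misses π(1), and any
--     other u would have to stand strictly right of n and strictly left of 1,
--     which is impossible when 1 stands at most one place right of n.
-- Neighbouring positions give both "at most one place" conditions, and the
-- theorem combines the two bounds with the count ∣{1, n}∣ = 2.

open import Defs
open import Data.Nat using (ℕ; suc; _≤_)
open import Data.Fin using (Fin; zero; suc; fromℕ; inject₁)
open import Data.Fin.Permutation using (Permutation′; _⟨$⟩ʳ_; _⟨$⟩ˡ_)
open import Data.Fin.Subset using (Subset; ⁅_⁆; _∪_; ∣_∣)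
open import Data.Product using (∃; _×_; _,_)
open import Data.Sum using (_⊎_)
open import Relation.Binary.PropositionalEquality using (_≡_; _≢_)

import Data.Nat as ℕ
import Data.Nat.Properties as ℕ
open import Data.Fin using (toℕ) renaming (_<_ to _<ᶠ_)
import Data.Fin.Properties as Fin
open import Data.Fin.Permutation using (inverseˡ; inverseʳ)
open import Data.Fin.Subset using (_-_) renaming (_∈_ to _∈ˢ_)
open import Data.Fin.Subset.Properties
  using (x∈⁅x⁆; x∈p∪q⁺; ∣⁅x⁆∣≡1; ∪-identityˡ; x∈p⇒∣p-x∣<∣p∣; x∈p∧x≢y⇒x∈p-y)
open import Data.Product using (proj₁; proj₂)
open import Data.Sum using (inj₁; inj₂) renaming (swap to ⊎-swap)
open import Data.Empty using (⊥-elim)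
open import Relation.Nullary using (¬_; yes; no)
open import Relation.Binary.Definitions using (tri<; tri≈; tri>)
open import Relation.Binary.PropositionalEquality using (refl; sym; cong; subst; module ≡-Reasoning)

distinct-members⇒2≤∣p∣ : ∀ {n} {p : Subset n} {x y : Fin n} →
  x ∈ˢ p → y ∈ˢ p → x ≢ y → 2 ≤ ∣ p ∣
distinct-members⇒2≤∣p∣ {p = p} {x} {y} x∈p y∈p x≢y =
  ℕ.≤-trans (ℕ.s≤s 1≤∣p-x∣) (x∈p⇒∣p-x∣<∣p∣ x∈p)
  where
    y∈p-x : y ∈ˢ p - x
    y∈p-x = x∈p∧x≢y⇒x∈p-y y∈p (λ y≡x → x≢y (sym y≡x))

    1≤∣p-x∣ : 1 ≤ ∣ p - x ∣
    1≤∣p-x∣ = ℕ.≤-trans (ℕ.s≤s ℕ.z≤n) (x∈p⇒∣p-x∣<∣p∣ y∈p-x)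

Neighbours : ∀ {n} → Fin n → Fin n → Set
Neighbours i j = toℕ j ≡ suc (toℕ i) ⊎ toℕ i ≡ suc (toℕ j)

neighbours⇒≤suc : ∀ {n} {i j : Fin n} → Neighbours i j → toℕ j ≤ suc (toℕ i)
neighbours⇒≤suc (inj₁ j≡1+i) = ℕ.≤-reflexive j≡1+i
neighbours⇒≤suc {j = j} (inj₂ i≡1+j) =
  ℕ.m≤n⇒m≤1+n (subst (toℕ j ≤_) (sym i≡1+j) (ℕ.n≤1+n (toℕ j)))

Universal : ∀ {n} → Permutation′ n → Fin n → Set
Universal {n} π u = (w : Fin n) → w ≡ u ⊎ Adj π u w

dominating-singleton⇒universal : ∀ {n} (π : Permutation′ n) {D : Subset n} {u : Fin n} →
  Dominating π D → (∀ {x} → x ∈ˢ D → x ≡ u) → Universal π u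
dominating-singleton⇒universal π dom only-u w with dom w
... | inj₁ w∈D               = inj₁ (only-u w∈D)
... | inj₂ (x , x∈D , x~w)   = inj₂ (subst (λ x → Adj π x w) (only-u x∈D) x~w)

no-universal⇒2≤∣D∣ : ∀ {n} (π : Permutation′ (suc n)) →
  (∀ u → ¬ Universal π u) → (D : Subset (suc n)) → Dominating π D → 2 ≤ ∣ D ∣
no-universal⇒2≤∣D∣ {n} π no-universal D dom with 2 ℕ.≤? ∣ D ∣
... | yes 2≤∣D∣ = 2≤∣D∣
... | no  2≰∣D∣ = ⊥-elim (no-universal u (dominating-singleton⇒universal π dom only-u))
  where
    -- D is nonempty, since the vertex 1 has to be dominated.
    some-member : ∃ λ u → u ∈ˢ D
    some-member with dom zero
    ... | inj₁ 0∈D             = zero , 0∈D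
    ... | inj₂ (u , u∈D , _)   = u , u∈D

    u : Fin (suc n)
    u = proj₁ some-member

    only-u : ∀ {x} → x ∈ˢ D → x ≡ u
    only-u {x} x∈D with x Fin.≟ u
    ... | yes x≡u = x≡u
    ... | no  x≢u = ⊥-elim (2≰∣D∣ (distinct-members⇒2≤∣p∣ x∈D (proj₂ some-member) x≢u))

module _ {m : ℕ} (π : Permutation′ (suc m)) where

  pos : Fin (suc m) → Fin (suc m)
  pos v = π ⟨$⟩ˡ v

  last : Fin (suc m)
  last = fromℕ m

  position-of : ∀ {q v} → π ⟨$⟩ʳ q ≡ v → pos v ≡ q
  position-of refl = inverseˡ π

  pos-injective : ∀ {v w} → pos v ≡ pos w → v ≡ w
  pos-injective {v} {w} pv≡pw = begin
    v                  ≡⟨ sym (inverseʳ π) ⟩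
    π ⟨$⟩ʳ pos v       ≡⟨ cong (π ⟨$⟩ʳ_) pv≡pw ⟩
    π ⟨$⟩ʳ pos w       ≡⟨ inverseʳ π ⟩
    w                  ∎
    where open ≡-Reasoning

  last≮ : ∀ (i : Fin (suc m)) → ¬ (last <ᶠ i)
  last≮ i last<i = ℕ.<⇒≱ last<i (Fin.≤fromℕ i)

  adj-zero⇒left : ∀ {w} → Adj π zero w → pos w <ᶠ pos zero
  adj-zero⇒left (inj₁ (_ , left)) = left

  left⇒adj-zero : ∀ {w} → pos w <ᶠ pos zero → Adj π zero w
  left⇒adj-zero {zero}  left = ⊥-elim (Fin.<-irrefl refl left)
  left⇒adj-zero {suc w} left = inj₁ (ℕ.z<s , left)

  adj-last⇒right : ∀ {w} → Adj π last w → pos last <ᶠ pos w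
  adj-last⇒right (inj₁ (last<w , _)) = ⊥-elim (last≮ _ last<w)
  adj-last⇒right (inj₂ (_ , right))  = right

  right⇒adj-last : ∀ {w} → pos last <ᶠ pos w → Adj π last w
  right⇒adj-last {w} right = inj₂ (Fin.≤∧≢⇒< (Fin.≤fromℕ w) w≢last , right)
    where
      w≢last : w ≢ last
      w≢last refl = Fin.<-irrefl refl right

  zero∈D : zero ∈ˢ ⁅ zero ⁆ ∪ ⁅ last ⁆
  zero∈D = x∈p∪q⁺ (inj₁ (x∈⁅x⁆ zero))

  last∈D : last ∈ˢ ⁅ zero ⁆ ∪ ⁅ last ⁆
  last∈D = x∈p∪q⁺ (inj₂ (x∈⁅x⁆ last))

  endpoints-dominate : toℕ (pos last) ≤ suc (toℕ (pos zero)) →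
    Dominating π (⁅ zero ⁆ ∪ ⁅ last ⁆)
  endpoints-dominate n-near-1 v with Fin.<-cmp (pos v) (pos last)
  ... | tri> _ _ right  = inj₂ (last , last∈D , right⇒adj-last right)
  ... | tri≈ _ same _   = inj₁ (subst (_∈ˢ _) (sym (pos-injective same)) last∈D)
  ... | tri< left-of-n _ _
        with ℕ.m≤n⇒m<n∨m≡n (ℕ.m<1+n⇒m≤n (ℕ.<-≤-trans left-of-n n-near-1))
  ...   | inj₁ left = inj₂ (zero , zero∈D , left⇒adj-zero left)
  ...   | inj₂ same = inj₁ (subst (_∈ˢ _) (sym (pos-injective (Fin.toℕ-injective same))) zero∈D)

  -- The vertex 1 is not universal unless π(n) = 1: the vertex π(n) in the last
  -- position is never left of 1.
  zero-not-universal : π ⟨$⟩ʳ last ≢ zero → ¬ Universal π zero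
  zero-not-universal πlast≢0 U with U (π ⟨$⟩ʳ last)
  ... | inj₁ πlast≡0 = πlast≢0 πlast≡0
  ... | inj₂ 0~πlast =
        last≮ (pos zero) (subst (_<ᶠ pos zero) (inverseˡ π) (adj-zero⇒left 0~πlast))

  -- The vertex n is not universal unless π(1) = n: the vertex π(1) in the first
  -- position is never right of n.
  last-not-universal : π ⟨$⟩ʳ zero ≢ last → ¬ Universal π last
  last-not-universal π0≢last U with U (π ⟨$⟩ʳ zero)
  ... | inj₁ π0≡last = π0≢last π0≡last
  ... | inj₂ n~π0 with subst (pos last <ᶠ_) (inverseˡ π) (adj-last⇒right n~π0)
  ...   | ()

  no-universal-vertex : toℕ (pos zero) ≤ suc (toℕ (pos last)) →
    π ⟨$⟩ʳ zero ≢ last → π ⟨$⟩ʳ last ≢ zero → ∀ u → ¬ Universal π u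
  no-universal-vertex 1-near-n π0≢last πlast≢0 u U with U zero | U last
  ... | inj₁ refl | _         = zero-not-universal πlast≢0 U
  ... | inj₂ _    | inj₁ refl = last-not-universal π0≢last U
  ... | inj₂ u~0  | inj₂ u~n  =
        ℕ.<⇒≱ (ℕ.≤-<-trans right-of-n left-of-1) 1-near-n
    where
      right-of-n : pos last <ᶠ pos u
      right-of-n = adj-last⇒right (⊎-swap u~n)
      left-of-1 : pos u <ᶠ pos zero
      left-of-1 = adj-zero⇒left (⊎-swap u~0)

  endpoints-neighbours :
    (∃ λ (p : Fin m) →
      ((π ⟨$⟩ʳ inject₁ p ≡ zero) × (π ⟨$⟩ʳ suc p ≡ last))
      ⊎ ((π ⟨$⟩ʳ inject₁ p ≡ last) × (π ⟨$⟩ʳ suc p ≡ zero))) →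
    Neighbours (pos zero) (pos last)
  endpoints-neighbours (p , inj₁ (at-p , at-p+1))
    rewrite position-of at-p | position-of at-p+1 = inj₁ (cong suc (sym (Fin.toℕ-inject₁ p)))
  endpoints-neighbours (p , inj₂ (at-p , at-p+1))
    rewrite position-of at-p | position-of at-p+1 = inj₂ (cong suc (sym (Fin.toℕ-inject₁ p)))

∣⁅first⁆∪⁅last⁆∣≡2 : ∀ k → ∣ ⁅ zero ⁆ ∪ ⁅ fromℕ (suc k) ⁆ ∣ ≡ 2
∣⁅first⁆∪⁅last⁆∣≡2 k rewrite ∪-identityˡ ⁅ fromℕ k ⁆ = cong suc (∣⁅x⁆∣≡1 (fromℕ k))

proposition2 : (m : ℕ) (π : Permutation′ (suc m)) →
    (∃ λ (p : Fin m) →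
      ((π ⟨$⟩ʳ inject₁ p ≡ zero) × (π ⟨$⟩ʳ suc p ≡ fromℕ m))
      ⊎ ((π ⟨$⟩ʳ inject₁ p ≡ fromℕ m) × (π ⟨$⟩ʳ suc p ≡ zero))) →
    π ⟨$⟩ʳ zero ≢ fromℕ m →
    π ⟨$⟩ʳ fromℕ m ≢ zero →
    Dominating π (⁅ zero ⁆ ∪ ⁅ fromℕ m ⁆)
      × ∣ ⁅ zero ⁆ ∪ ⁅ fromℕ m ⁆ ∣ ≡ 2
      × ((D : Subset (suc m)) → Dominating π D → 2 ≤ ∣ D ∣)
proposition2 (suc k) π 1-n-adjacent π0≢n πn≢0 =
    endpoints-dominate π (neighbours⇒≤suc neighbours)
  , ∣⁅first⁆∪⁅last⁆∣≡2 k
  , no-universal⇒2≤∣D∣ π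
      (no-universal-vertex π (neighbours⇒≤suc (⊎-swap neighbours)) π0≢n πn≢0)
  where
    neighbours : Neighbours (pos π zero) (pos π (last π))
    neighbours = endpoints-neighbours π 1-n-adjacent
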